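{- Let $n\ge1$ and $t\ge n$ be integers. Then every element of the Tamari lattice $\mathrm{Tam}_n$ is $t$-$\mathsf{Pop}$-sortable.
   Context: For $n\ge1$, a Dyck path of semilength $n$ is a word in the letters $\mathrm{N}$ and $\mathrm{E}$ containing $n$ of each letter, such that every prefix contains at least as many $\mathrm{N}$'s as $\mathrm{E}$'s. The Tamari lattice $\mathrm{Tam}_n$ is the set of Dyck paths of semilength $n$, partially ordered by the reflexive-transitive closure of the covering relation $\mu\lessdot\mu'$ whenever $\mu=X\,\mathrm{E}\,D\,Y$ and $\mu'=X\,D\,\mathrm{E}\,Y$ for words $X,Y$ and $D=\mathrm{N}D'\mathrm{E}$ with $D'$ a (possibly empty) word having equally many $\mathrm{N}$'s and $\mathrm{E}$'s and every prefix having at least as many $\mathrm{N}$'s as $\mathrm{E}$'s. Its minimum is $(\mathrm{NE})^n$. For a finite lattice $M$, $\mathsf{Pop}_M(x)=\bigwedge(\{y\in M:y\lessdot x\}\cup\{x\})$, and $x$ is $t$-$\mathsf{Pop}$-sortable if $\mathsf{Pop}_M^t(x)$ is the minimum of $M$. -}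

module Defs where

open import Data.Nat using (ℕ; zero; suc; _*_)
open import Data.List using (List; []; _∷_; _++_; length; replicate; concat)
open import Data.Product using (Σ; _×_; _,_; ∃)
open import Data.Sum using (_⊎_)
open import Relation.Nullary using (¬_)
open import Relation.Binary.PropositionalEquality using (_≡_)
open import Relation.Binary.Construct.Closure.ReflexiveTransitive using (Star)

data Step : Set where
  N E : Step

Word : Set
Word = List Step

-- Ballot k w : reading w starting at height k, the height never goes
-- negative and ends at 0.  Ballot 0 w says: w has equally many N's and E's
-- and every prefix has at least as many N's as E's (possibly empty).
data Ballot : ℕ → Word → Set where
  done : Ballot 0 []
  up   : ∀ {k w} → Ballot (suc k) w → Ballot k (N ∷ w)
  down : ∀ {k w} → Ballot k w → Ballot (suc k) (E ∷ w)

Dyck : ℕ → Word → Set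
Dyck n w = Ballot 0 w × length w ≡ n * 2

Move : Word → Word → Set
Move μ μ' = Σ Word λ X → Σ Word λ Y → Σ Word λ D' →
  Ballot 0 D' ×
  (μ ≡ X ++ (E ∷ (N ∷ D' ++ E ∷ [])) ++ Y) ×
  (μ' ≡ X ++ (N ∷ D' ++ E ∷ []) ++ (E ∷ Y))

_≤T_ : Word → Word → Set
μ ≤T μ' = Star Move μ μ'

_<T_ : Word → Word → Set
y <T x = y ≤T x × ¬ (y ≡ x)

Covers : ℕ → Word → Word → Set
Covers n y x = Dyck n y × y <T x ×
  (∀ z → Dyck n z → y <T z → ¬ (z <T x))

PopSet : ℕ → Word → Word → Set
PopSet n x y = Covers n y x ⊎ y ≡ x

IsMeet : ℕ → (Word → Set) → Word → Set
IsMeet n S m = Dyck n m × (∀ y → S y → m ≤T y) ×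
  (∀ l → Dyck n l → (∀ y → S y → l ≤T y) → l ≤T m)

IsPop : ℕ → Word → Word → Set
IsPop n x p = IsMeet n (PopSet n x) p

data PopIter (n : ℕ) : ℕ → Word → Word → Set where
  pop-zero : ∀ {x} → PopIter n 0 x x
  pop-suc  : ∀ {t x y z} → IsPop n x y → PopIter n t y z → PopIter n (suc t) x z

minTam : ℕ → Word
minTam n = concat (replicate n (N ∷ E ∷ []))

PopSortable : ℕ → ℕ → Word → Set
PopSortable n t x = PopIter n t x (minTam n)

-- Read a Dyck word as a binary tree, word (node l r) = word l N word r E.  Tamari
-- moves become rotations (xy)z → x(yz), and by Huang–Tamari the Tamari order becomes
-- the componentwise order on bracket vectors, listing for each node in in-order one
-- more than the size of its right subtree; bracket vectors are laminar (the
-- intervals [i, i + v i) are nested or disjoint), which is what lets rotations climb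
-- to any vector above.  The lower covers of T undo one rotation each, so Pop T is
-- the tree whose bracket vector gives each node one more than the size of the left
-- subtree of its right child.  This lowers every entry above 1, all entries start
-- at most n, and the only tree with all entries 1 is the left comb, whose word is
-- (NE)^n; hence n - 1 applications of Pop reach the minimum.

module Submission where

open import Defs
open import Data.Nat using (ℕ; zero; suc; pred; _+_; _*_; _≤_; _<_; z≤n; s≤s; z<s; _≟_; _<?_; >-nonZero)
open import Data.Nat.Properties
open import Data.Nat.ListAction using (sum)
open import Data.List using (List; []; _∷_; _++_; length; foldl)
open import Data.List.Properties using (++-assoc; ++-identityʳ; length-++; foldl-++; ∷-injectiveʳ; ≡-dec)
open import Data.List.Relation.Binary.Pointwise as Pointwise
  using (Pointwise; []; _∷_; Pointwise-length; Pointwise-≡⇒≡; ≡⇒Pointwise-≡)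
open import Data.List.Relation.Unary.All as All using (All; []; _∷_)
open import Data.List.Relation.Unary.All.Properties using (++⁺; ++⁻ˡ; ++⁻ʳ)
open import Data.Product using (∃; ∃₂; _×_; _,_; proj₁; proj₂)
open import Data.Sum using (_⊎_; inj₁; inj₂)
open import Data.Empty using (⊥-elim)
open import Function using (_∘_)
open import Relation.Nullary using (¬_; yes; no; Dec)
open import Relation.Binary using (tri<; tri≈; tri>)
open import Relation.Binary.PropositionalEquality
open import Relation.Binary.Construct.Closure.ReflexiveTransitive using (Star; ε; _◅_; gmap)

private
  variable
    a b c k : ℕ
    u v : Word
    μ μ′ : Word

-- Trees and Dyck words

data Tree : Set where
  leaf : Tree
  node : Tree → Tree → Tree

size : Tree → ℕ
size leaf       = 0
size (node l r) = size l + suc (size r)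

word : Tree → Word
word leaf       = []
word (node l r) = word l ++ N ∷ word r ++ E ∷ []

word-length : ∀ T → length (word T) ≡ size T * 2
word-length leaf       = refl
word-length (node l r) = begin
  length (word l ++ N ∷ word r ++ E ∷ [])
    ≡⟨ length-++ (word l) ⟩
  length (word l) + suc (length (word r ++ E ∷ []))
    ≡⟨ cong (λ m → length (word l) + suc m) (length-++ (word r)) ⟩
  length (word l) + suc (length (word r) + 1)
    ≡⟨ cong₂ (λ m m′ → m + suc (m′ + 1)) (word-length l) (word-length r) ⟩
  size l * 2 + suc (size r * 2 + 1)
    ≡⟨ cong (λ m → size l * 2 + suc m) (+-comm (size r * 2) 1) ⟩
  size l * 2 + suc (size r) * 2
    ≡⟨ *-distribʳ-+ 2 (size l) (suc (size r)) ⟨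
  size (node l r) * 2 ∎
  where open ≡-Reasoning

data Path : ℕ → ℕ → Word → Set where
  end  : Path a a []
  up   : Path (suc a) b u → Path a b (N ∷ u)
  down : Path a b u → Path (suc a) b (E ∷ u)

Ballot⇒Path : Ballot a u → Path a 0 u
Ballot⇒Path done     = end
Ballot⇒Path (up b)   = up (Ballot⇒Path b)
Ballot⇒Path (down b) = down (Ballot⇒Path b)

Path⇒Ballot : Path a 0 u → Ballot a u
Path⇒Ballot end      = done
Path⇒Ballot (up p)   = up (Path⇒Ballot p)
Path⇒Ballot (down p) = down (Path⇒Ballot p)

Path-++ : Path a b u → Path b c v → Path a c (u ++ v)
Path-++ end      q = q
Path-++ (up p)   q = up (Path-++ p q)
Path-++ (down p) q = down (Path-++ p q)

Path-split : ∀ u → Path a c (u ++ v) → ∃ λ b → Path a b u × Path b c v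
Path-split []      p        = _ , end , p
Path-split (N ∷ u) (up p)   with Path-split u p
... | b , p₁ , p₂ = b , up p₁ , p₂
Path-split (E ∷ u) (down p) with Path-split u p
... | b , p₁ , p₂ = b , down p₁ , p₂

Path-raise : ∀ k → Path a b u → Path (a + k) (b + k) u
Path-raise k end      = end
Path-raise k (up p)   = up (Path-raise k p)
Path-raise k (down p) = down (Path-raise k p)

Path-end-unique : Path a b u → Path a c u → b ≡ c
Path-end-unique end      end      = refl
Path-end-unique (up p)   (up q)   = Path-end-unique p q
Path-end-unique (down p) (down q) = Path-end-unique p q

word-Path : ∀ T → Path a a (word T)
word-Path leaf       = end
word-Path (node l r) = Path-++ (word-Path l) (up (Path-++ (word-Path r) (down end)))

word-dyck : ∀ T → Dyck (size T) (word T)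
word-dyck T = Path⇒Ballot (word-Path T) , word-length T

-- D returns to the height it starts from, so it can equally be read one level higher.
Move-ballot : Move μ μ′ → Ballot 0 μ → Ballot 0 μ′
Move-ballot (X , Y , D , bD , refl , refl) b with Path-split X (Ballot⇒Path b)
... | suc h , pX , down (up q) with Path-split (D ++ E ∷ []) q
... | _ , pDE , pY with Path-split D pDE
... | _ , pD , down end with Path-end-unique pD (Path-raise (suc h) (Ballot⇒Path bD))
... | refl = Path⇒Ballot (Path-++ pX (up (Path-++ (Path-++ pD′ (down end)) (down pY))))
  where pD′ = Path-raise (suc (suc h)) (Ballot⇒Path bD)

State : Set
State = Tree × List Tree

-- A shift-reduce parser inverting word: N pushes the current tree and starts a
-- new one, E pops s and builds node s t.  An E on an empty stack never occurs
-- in a ballot word.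
step : State → Step → State
step (t , ts)     N = leaf , t ∷ ts
step (t , [])     E = t , []
step (t , s ∷ ts) E = node s t , ts

run : State → Word → State
run = foldl step

decode : Word → Tree
decode u = proj₁ (run (leaf , []) u)

graft : Tree → Tree → Tree
graft s leaf       = s
graft s (node l r) = node (graft s l) r

graft-leaf : ∀ T → graft leaf T ≡ T
graft-leaf leaf       = refl
graft-leaf (node l r) = cong (λ l′ → node l′ r) (graft-leaf l)

run-word : ∀ t ts T → run (t , ts) (word T) ≡ (graft t T , ts)
run-word t ts leaf       = refl
run-word t ts (node l r) = begin
  run (t , ts) (word l ++ N ∷ word r ++ E ∷ [])         ≡⟨ foldl-++ step _ (word l) _ ⟩
  run (run (t , ts) (word l)) (N ∷ word r ++ E ∷ [])    ≡⟨ cong (λ s → run s (N ∷ word r ++ E ∷ [])) (run-word t ts l) ⟩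
  run (leaf , graft t l ∷ ts) (word r ++ E ∷ [])        ≡⟨ foldl-++ step _ (word r) _ ⟩
  run (run (leaf , graft t l ∷ ts) (word r)) (E ∷ [])   ≡⟨ cong (λ s → run s (E ∷ [])) (run-word leaf _ r) ⟩
  (node (graft t l) (graft leaf r) , ts)                ≡⟨ cong (λ r′ → node (graft t l) r′ , ts) (graft-leaf r) ⟩
  (node (graft t l) r , ts)                             ∎
  where open ≡-Reasoning

run-word-initial : ∀ T → run (leaf , []) (word T) ≡ (T , [])
run-word-initial T = trans (run-word leaf [] T) (cong (_, []) (graft-leaf T))

decode-word : ∀ T → decode (word T) ≡ T
decode-word T = cong proj₁ (run-word-initial T)

word-injective : ∀ {T T′} → word T ≡ word T′ → T ≡ T′
word-injective {T} {T′} eq = trans (sym (decode-word T)) (trans (cong decode eq) (decode-word T′))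

-- The word already read when the parser's stack holds ts.
pending : List Tree → Word
pending []       = []
pending (t ∷ ts) = pending ts ++ word t ++ N ∷ []

word-run : ∀ {t ts} → Ballot k u → length ts ≡ k →
  word (proj₁ (run (t , ts) u)) ≡ pending ts ++ word t ++ u
word-run {t = t} {[]} done refl = sym (++-identityʳ (word t))
word-run {u = N ∷ u} {t} {ts} (up b) refl = begin
  word (proj₁ (run (leaf , t ∷ ts) u))    ≡⟨ word-run b refl ⟩
  (pending ts ++ word t ++ N ∷ []) ++ u   ≡⟨ ++-assoc (pending ts) _ u ⟩
  pending ts ++ (word t ++ N ∷ []) ++ u   ≡⟨ cong (pending ts ++_) (++-assoc (word t) _ u) ⟩
  pending ts ++ word t ++ N ∷ u           ∎
  where open ≡-Reasoning
word-run {u = E ∷ u} {t} {s ∷ ts} (down b) refl = begin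
  word (proj₁ (run (node s t , ts) u))                       ≡⟨ word-run b refl ⟩
  pending ts ++ (word s ++ N ∷ word t ++ E ∷ []) ++ u
    ≡⟨ cong (pending ts ++_) (++-assoc (word s) _ u) ⟩
  pending ts ++ word s ++ N ∷ (word t ++ E ∷ []) ++ u
    ≡⟨ cong (λ z → pending ts ++ word s ++ N ∷ z) (++-assoc (word t) _ u) ⟩
  pending ts ++ word s ++ (N ∷ []) ++ word t ++ E ∷ u
    ≡⟨ cong (pending ts ++_) (++-assoc (word s) (N ∷ []) _) ⟨
  pending ts ++ (word s ++ N ∷ []) ++ word t ++ E ∷ u       ≡⟨ ++-assoc (pending ts) _ _ ⟨
  (pending ts ++ word s ++ N ∷ []) ++ word t ++ E ∷ u       ∎
  where open ≡-Reasoning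

word-decode : Ballot 0 u → word (decode u) ≡ u
word-decode b = word-run b refl

parse : Ballot 0 u → ∃ λ T → word T ≡ u
parse {u} b = decode u , word-decode b

dyck⇒tree : ∀ {n x} → Dyck n x → ∃ λ T → word T ≡ x × size T ≡ n
dyck⇒tree {n} (b , len) with parse b
... | T , refl = T , refl , *-cancelʳ-≡ (size T) n 2 (trans (sym (word-length T)) len)

-- Rotations and Tamari moves

data Rotation : Tree → Tree → Set where
  rotate : ∀ {x y z} → Rotation (node (node x y) z) (node x (node y z))
  left   : ∀ {l l′ r} → Rotation l l′ → Rotation (node l r) (node l′ r)
  right  : ∀ {l r r′} → Rotation r r′ → Rotation (node l r) (node l r′)

Rotation-size : ∀ {T T′} → Rotation T T′ → size T ≡ size T′
Rotation-size (rotate {x} {y} {z}) = +-assoc (size x) (suc (size y)) (suc (size z))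
Rotation-size (left {r = r} ρ)     = cong (λ m → m + suc (size r)) (Rotation-size ρ)
Rotation-size (right {l} ρ)        = cong (λ m → size l + suc m) (Rotation-size ρ)

Move-irreflexive : Move μ μ′ → μ ≢ μ′
Move-irreflexive (X , Y , D , _ , refl , refl) = E∷≢N∷ X
  where
  E∷≢N∷ : ∀ X {w w′} → X ++ E ∷ w ≢ X ++ N ∷ w′
  E∷≢N∷ []      ()
  E∷≢N∷ (_ ∷ X) eq = E∷≢N∷ X (∷-injectiveʳ eq)

Move-prepend : ∀ Z → Move μ μ′ → Move (Z ++ μ) (Z ++ μ′)
Move-prepend Z (X , Y , D , bD , refl , refl) =
  Z ++ X , Y , D , bD , sym (++-assoc Z X _) , sym (++-assoc Z X _)

Move-append : ∀ Z → Move μ μ′ → Move (μ ++ Z) (μ′ ++ Z)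
Move-append Z (X , Y , D , bD , refl , refl) =
  X , Y ++ Z , D , bD ,
  trans (++-assoc X _ Z) (cong (X ++_) (++-assoc (E ∷ N ∷ D ++ E ∷ []) Y Z)) ,
  trans (++-assoc X _ Z) (cong (X ++_) (++-assoc (N ∷ D ++ E ∷ []) (E ∷ Y) Z))

Rotation⇒Move : ∀ {T T′} → Rotation T T′ → Move (word T) (word T′)
Rotation⇒Move (rotate {x} {y} {z}) =
  word x ++ N ∷ word y , [] , word z , Path⇒Ballot (word-Path z) , source , target
  where
  open ≡-Reasoning
  source : word (node (node x y) z) ≡ (word x ++ N ∷ word y) ++ (E ∷ word (node leaf z)) ++ []
  source = begin
    (word x ++ N ∷ word y ++ E ∷ []) ++ word (node leaf z)    ≡⟨ ++-assoc (word x) _ _ ⟩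
    word x ++ N ∷ (word y ++ E ∷ []) ++ word (node leaf z)    ≡⟨ cong (λ w → word x ++ N ∷ w) (++-assoc (word y) _ _) ⟩
    word x ++ N ∷ word y ++ E ∷ word (node leaf z)            ≡⟨ ++-assoc (word x) _ _ ⟨
    (word x ++ N ∷ word y) ++ E ∷ word (node leaf z)          ≡⟨ cong ((word x ++ N ∷ word y) ++_) (++-identityʳ _) ⟨
    (word x ++ N ∷ word y) ++ (E ∷ word (node leaf z)) ++ []  ∎
  target : word (node x (node y z)) ≡ (word x ++ N ∷ word y) ++ word (node leaf z) ++ E ∷ []
  target = begin
    word x ++ N ∷ (word y ++ word (node leaf z)) ++ E ∷ []    ≡⟨ cong (λ w → word x ++ N ∷ w) (++-assoc (word y) _ _) ⟩
    word x ++ N ∷ word y ++ word (node leaf z) ++ E ∷ []      ≡⟨ ++-assoc (word x) _ _ ⟨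
    (word x ++ N ∷ word y) ++ word (node leaf z) ++ E ∷ []    ∎
Rotation⇒Move (left {r = r} ρ) = Move-append (N ∷ word r ++ E ∷ []) (Rotation⇒Move ρ)
Rotation⇒Move (right {l} ρ)    =
  Move-prepend (word l) (Move-prepend (N ∷ []) (Move-append (E ∷ []) (Rotation⇒Move ρ)))

data StackRotation : List Tree → List Tree → Set where
  here  : ∀ {s s′ ts} → Rotation s s′ → StackRotation (s ∷ ts) (s′ ∷ ts)
  there : ∀ {s ts ts′} → StackRotation ts ts′ → StackRotation (s ∷ ts) (s ∷ ts′)

data StateRotation : State → State → Set where
  current : ∀ {t t′ ts} → Rotation t t′ → StateRotation (t , ts) (t′ , ts)
  stacked : ∀ {t ts ts′} → StackRotation ts ts′ → StateRotation (t , ts) (t , ts′)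

step-rotation : ∀ {s s′} d → StateRotation s s′ → StateRotation (step s d) (step s′ d)
step-rotation N (current ρ)                 = stacked (here ρ)
step-rotation N (stacked σ)                 = stacked (there σ)
step-rotation {_ , []}    E (current ρ)     = current ρ
step-rotation {_ , _ ∷ _} E (current ρ)     = current (right ρ)
step-rotation E (stacked (here ρ))          = current (left ρ)
step-rotation E (stacked (there σ))         = stacked σ

run-rotation : ∀ {s s′} u → StateRotation s s′ → StateRotation (run s u) (run s′ u)
run-rotation []      σ = σ
run-rotation (d ∷ u) σ = run-rotation u (step-rotation d σ)

StateRotation⇒Rotation : ∀ {T T′} → StateRotation (T , []) (T′ , []) → Rotation T T′
StateRotation⇒Rotation (current ρ) = ρ

run-block : ∀ s B → let β = word (node leaf B) in
  run s (E ∷ β) ≡ step (run s β) E ⊎ StateRotation (run s (E ∷ β)) (step (run s β) E)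
run-block (t , [])     B rewrite run-word t [] (node leaf B) = inj₁ refl
run-block (t , s ∷ ts) B rewrite run-word (node s t) ts (node leaf B) | run-word t (s ∷ ts) (node leaf B) =
  inj₂ (current rotate)

run-++₃ : ∀ s X u Y → run s (X ++ u ++ Y) ≡ run (run (run s X) u) Y
run-++₃ s X u Y = trans (foldl-++ step s X (u ++ Y)) (foldl-++ step (run s X) u Y)

Move⇒Rotation : ∀ {T T′} → Move (word T) (word T′) → Rotation T T′
Move⇒Rotation {T} {T′} m@(X , Y , _ , bD , eq , eq′) with parse bD
... | B , refl = conclude (run-block s B)
  where
  s = run (leaf , []) X
  β = word (node leaf B)
  source : run (run s (E ∷ β)) Y ≡ (T , [])
  source = trans (sym (trans (cong (run (leaf , [])) eq) (run-++₃ _ X (E ∷ β) Y))) (run-word-initial T)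
  target : run (step (run s β) E) Y ≡ (T′ , [])
  target = trans (sym (trans (cong (run (leaf , [])) eq′) (run-++₃ _ X β (E ∷ Y)))) (run-word-initial T′)
  conclude : run s (E ∷ β) ≡ step (run s β) E ⊎ StateRotation (run s (E ∷ β)) (step (run s β) E) →
             Rotation T T′
  conclude (inj₁ same) = ⊥-elim (Move-irreflexive m (cong (word ∘ proj₁) same-result))
    where same-result = trans (sym source) (trans (cong (λ s′ → run s′ Y) same) target)
  conclude (inj₂ σ) = StateRotation⇒Rotation (subst₂ StateRotation source target (run-rotation Y σ))

-- Bracket vectors

module _ {A B : Set} {R : A → B → Set} where

  Pointwise-splitˡ : ∀ xs {ys zs} → Pointwise R (xs ++ ys) zs →
    ∃₂ λ zs₁ zs₂ → zs ≡ zs₁ ++ zs₂ × Pointwise R xs zs₁ × Pointwise R ys zs₂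
  Pointwise-splitˡ []       rs       = [] , _ , refl , [] , rs
  Pointwise-splitˡ (x ∷ xs) (r ∷ rs) with Pointwise-splitˡ xs rs
  ... | zs₁ , zs₂ , refl , rs₁ , rs₂ = _ ∷ zs₁ , zs₂ , refl , r ∷ rs₁ , rs₂

  Pointwise-splitʳ : ∀ zs {xs ws} → Pointwise R xs (zs ++ ws) →
    ∃₂ λ xs₁ xs₂ → xs ≡ xs₁ ++ xs₂ × Pointwise R xs₁ zs × Pointwise R xs₂ ws
  Pointwise-splitʳ []       rs       = [] , _ , refl , [] , rs
  Pointwise-splitʳ (z ∷ zs) (r ∷ rs) with Pointwise-splitʳ zs rs
  ... | xs₁ , xs₂ , refl , rs₁ , rs₂ = _ ∷ xs₁ , xs₂ , refl , r ∷ rs₁ , rs₂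

  Pointwise-++⁻ : ∀ ws {xs ys zs} → length ws ≡ length xs → Pointwise R (ws ++ ys) (xs ++ zs) →
    Pointwise R ws xs × Pointwise R ys zs
  Pointwise-++⁻ []       {[]}    refl rs       = [] , rs
  Pointwise-++⁻ (w ∷ ws) {x ∷ xs} len  (r ∷ rs) with Pointwise-++⁻ ws (suc-injective len) rs
  ... | rs₁ , rs₂ = r ∷ rs₁ , rs₂

++-injective : ∀ {A : Set} (ws : List A) {xs ys zs} → length ws ≡ length xs →
  ws ++ ys ≡ xs ++ zs → ws ≡ xs × ys ≡ zs
++-injective ws len eq with Pointwise-++⁻ ws len (≡⇒Pointwise-≡ eq)
... | eq₁ , eq₂ = Pointwise-≡⇒≡ eq₁ , Pointwise-≡⇒≡ eq₂

infix 4 _≤ᵥ_ _<ᵥ_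

_≤ᵥ_ : List ℕ → List ℕ → Set
_≤ᵥ_ = Pointwise _≤_

data _<ᵥ_ : List ℕ → List ℕ → Set where
  here  : ∀ {x y xs ys} → x < y → xs ≤ᵥ ys → x ∷ xs <ᵥ y ∷ ys
  there : ∀ {x y xs ys} → x ≤ y → xs <ᵥ ys → x ∷ xs <ᵥ y ∷ ys

≤ᵥ-refl : ∀ {xs} → xs ≤ᵥ xs
≤ᵥ-refl = Pointwise.refl ≤-refl

≤ᵥ-trans : ∀ {xs ys zs} → xs ≤ᵥ ys → ys ≤ᵥ zs → xs ≤ᵥ zs
≤ᵥ-trans = Pointwise.transitive ≤-trans

≤ᵥ-antisym : ∀ {xs ys} → xs ≤ᵥ ys → ys ≤ᵥ xs → xs ≡ ys
≤ᵥ-antisym p q = Pointwise-≡⇒≡ (Pointwise.antisymmetric ≤-antisym p q)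

<ᵥ⇒≤ᵥ : ∀ {xs ys} → xs <ᵥ ys → xs ≤ᵥ ys
<ᵥ⇒≤ᵥ (here p ps)  = <⇒≤ p ∷ ps
<ᵥ⇒≤ᵥ (there p ps) = p ∷ <ᵥ⇒≤ᵥ ps

<ᵥ-irrefl : ∀ {xs} → ¬ (xs <ᵥ xs)
<ᵥ-irrefl (here p _)  = n≮n _ p
<ᵥ-irrefl (there _ p) = <ᵥ-irrefl p

<ᵥ-++⁺ˡ : ∀ {as bs xs ys} → as ≤ᵥ bs → xs <ᵥ ys → as ++ xs <ᵥ bs ++ ys
<ᵥ-++⁺ˡ []       q = q
<ᵥ-++⁺ˡ (p ∷ ps) q = there p (<ᵥ-++⁺ˡ ps q)

<ᵥ-++⁺ʳ : ∀ {as bs xs ys} → xs <ᵥ ys → as ≤ᵥ bs → xs ++ as <ᵥ ys ++ bs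
<ᵥ-++⁺ʳ (here p ps)  q = here p (Pointwise.++⁺ ps q)
<ᵥ-++⁺ʳ (there p ps) q = there p (<ᵥ-++⁺ʳ ps q)

sum-mono-≤ᵥ : ∀ {xs ys} → xs ≤ᵥ ys → sum xs ≤ sum ys
sum-mono-≤ᵥ []       = ≤-refl
sum-mono-≤ᵥ (p ∷ ps) = +-mono-≤ p (sum-mono-≤ᵥ ps)

sum-mono-<ᵥ : ∀ {xs ys} → xs <ᵥ ys → sum xs < sum ys
sum-mono-<ᵥ (here p ps)  = +-mono-<-≤ p (sum-mono-≤ᵥ ps)
sum-mono-<ᵥ (there p ps) = +-mono-≤-< p (sum-mono-<ᵥ ps)

bracket : Tree → List ℕ
bracket leaf       = []
bracket (node l r) = bracket l ++ suc (size r) ∷ bracket r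

bracket-length : ∀ T → length (bracket T) ≡ size T
bracket-length leaf       = refl
bracket-length (node l r) =
  trans (length-++ (bracket l)) (cong₂ (λ m m′ → m + suc m′) (bracket-length l) (bracket-length r))

Rotation-bracket : ∀ {T T′} → Rotation T T′ → bracket T <ᵥ bracket T′
Rotation-bracket (rotate {x} {y} {z}) =
  subst (_<ᵥ bracket (node x (node y z))) (sym (++-assoc (bracket x) (suc (size y) ∷ bracket y) _))
    (<ᵥ-++⁺ˡ (≤ᵥ-refl {bracket x}) (here (s≤s (m<m+n (size y) z<s)) ≤ᵥ-refl))
Rotation-bracket (left ρ)  = <ᵥ-++⁺ʳ (Rotation-bracket ρ) ≤ᵥ-refl
Rotation-bracket (right {l} ρ) =
  <ᵥ-++⁺ˡ (≤ᵥ-refl {bracket l}) (there (≤-reflexive (cong suc (Rotation-size ρ))) (Rotation-bracket ρ))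

Rotation-irrefl : ∀ {T T′} → Rotation T T′ → T ≢ T′
Rotation-irrefl ρ refl = <ᵥ-irrefl (Rotation-bracket ρ)

Star-bracket : ∀ {T T′} → Star Rotation T T′ → bracket T ≤ᵥ bracket T′
Star-bracket ε       = ≤ᵥ-refl
Star-bracket (ρ ◅ σ) = ≤ᵥ-trans (<ᵥ⇒≤ᵥ (Rotation-bracket ρ)) (Star-bracket σ)

-- Entries past the end are 0.
entry : List ℕ → ℕ → ℕ
entry []       _       = 0
entry (x ∷ xs) zero    = x
entry (x ∷ xs) (suc i) = entry xs i

entry-++ˡ : ∀ xs {ys} i → i < length xs → entry (xs ++ ys) i ≡ entry xs i
entry-++ˡ (x ∷ xs) zero    _       = refl
entry-++ˡ (x ∷ xs) (suc i) (s≤s p) = entry-++ˡ xs i p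

entry-++ʳ : ∀ xs {ys} i → entry (xs ++ ys) (length xs + i) ≡ entry ys i
entry-++ʳ []       i = refl
entry-++ʳ (x ∷ xs) i = entry-++ʳ xs i

entry-length : ∀ xs {y ys} → entry (xs ++ y ∷ ys) (length xs) ≡ y
entry-length []       = refl
entry-length (x ∷ xs) = entry-length xs

entry-beyond : ∀ xs i → length xs ≤ i → entry xs i ≡ 0
entry-beyond []       i       _       = refl
entry-beyond (x ∷ xs) (suc i) (s≤s p) = entry-beyond xs i p

data Position (a i : ℕ) : Set where
  before : i < a → Position a i
  at     : i ≡ a → Position a i
  after  : ∀ j → i ≡ a + suc j → Position a i

position : ∀ a i → Position a i
position zero    zero    = at refl
position zero    (suc i) = after i refl
position (suc a) zero    = before z<s
position (suc a) (suc i) with position a i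
... | before p  = before (s≤s p)
... | at p      = at (cong suc p)
... | after j p = after j (cong suc p)

module _ (l r : Tree) where

  entry-node-left : ∀ i → i < size l → entry (bracket (node l r)) i ≡ entry (bracket l) i
  entry-node-left i p = entry-++ˡ (bracket l) i (subst (i <_) (sym (bracket-length l)) p)

  entry-node-root : entry (bracket (node l r)) (size l) ≡ suc (size r)
  entry-node-root = subst (λ i → entry (bracket (node l r)) i ≡ suc (size r)) (bracket-length l)
                      (entry-length (bracket l))

  entry-node-right : ∀ j → entry (bracket (node l r)) (size l + suc j) ≡ entry (bracket r) j
  entry-node-right j = subst (λ i → entry (bracket (node l r)) (i + suc j) ≡ entry (bracket r) j)
                         (bracket-length l) (entry-++ʳ (bracket l) (suc j))

bracket-bounded : ∀ T i → i < size T → i + entry (bracket T) i ≤ size T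
bracket-bounded (node l r) i p with position (size l) i
... | before q rewrite entry-node-left l r i q = ≤-trans (bracket-bounded l i q) (m≤m+n _ _)
... | at refl  rewrite entry-node-root l r     = ≤-refl
... | after j refl rewrite entry-node-right l r j | +-assoc (size l) (suc j) (entry (bracket r) j) =
  +-monoʳ-≤ (size l) (s≤s (bracket-bounded r j (<-pred (+-cancelˡ-< (size l) _ _ p))))

-- The intervals [i, i + v i) form a laminar family: any two are nested or disjoint.
Laminar : List ℕ → Set
Laminar v = ∀ i j → i < j → j < i + entry v i → j + entry v j ≤ i + entry v i

bracket-laminar : ∀ T → Laminar (bracket T)
bracket-laminar leaf i j i<j j< = ⊥-elim (<-asym i<j (subst (j <_) (+-identityʳ i) j<))
bracket-laminar (node l r) i j i<j j< with position (size l) i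
... | before p rewrite entry-node-left l r i p with j <? size l
...   | yes q rewrite entry-node-left l r j q = bracket-laminar l i j i<j j<
...   | no q = ⊥-elim (q (<-≤-trans j< (bracket-bounded l i p)))
bracket-laminar (node l r) i j i<j j< | at refl rewrite entry-node-root l r with position (size l) j
...   | before q = ⊥-elim (<-asym i<j q)
...   | at refl = ⊥-elim (<-irrefl refl i<j)
...   | after q refl rewrite entry-node-right l r q | +-assoc (size l) (suc q) (entry (bracket r) q) =
  +-monoʳ-≤ (size l) (s≤s (bracket-bounded r q (<-pred (+-cancelˡ-< (size l) _ _ j<))))
bracket-laminar (node l r) i j i<j j< | after p refl rewrite entry-node-right l r p with position (size l) j
...   | before q = ⊥-elim (<-asym (<-trans (m<m+n (size l) z<s) i<j) q)
...   | at refl = ⊥-elim (<-asym (m<m+n (size l) z<s) i<j)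
...   | after q refl rewrite entry-node-right l r q | +-assoc (size l) (suc q) (entry (bracket r) q)
                                                     | +-assoc (size l) (suc p) (entry (bracket r) p) =
  +-monoʳ-≤ (size l) (s≤s (bracket-laminar r p q (<-pred (+-cancelˡ-< (size l) _ _ i<j))
                                                 (<-pred (+-cancelˡ-< (size l) _ _ j<))))

Laminar-prefix : ∀ xs {ys} → Laminar (xs ++ ys) → Laminar xs
Laminar-prefix xs {ys} L i j i<j j< with i <? length xs
... | no p rewrite entry-beyond xs i (≮⇒≥ p) = ⊥-elim (<-asym i<j (subst (j <_) (+-identityʳ i) j<))
... | yes p with j <? length xs
...   | yes q = subst₂ (λ e e′ → j + e ≤ i + e′) (entry-++ˡ xs j q) (entry-++ˡ xs i p)
                  (L i j i<j (subst (λ e → j < i + e) (sym (entry-++ˡ xs i p)) j<))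
...   | no q rewrite entry-beyond xs j (≮⇒≥ q) | +-identityʳ j = <⇒≤ j<

Laminar-suffix : ∀ xs {ys} → Laminar (xs ++ ys) → Laminar ys
Laminar-suffix xs {ys} L i j i<j j< = +-cancelˡ-≤ (length xs) _ _ nested
  where
  shift : ∀ m → length xs + m + entry ys m ≡ length xs + (m + entry ys m)
  shift m = +-assoc (length xs) m _
  nested : length xs + (j + entry ys j) ≤ length xs + (i + entry ys i)
  nested with L (length xs + i) (length xs + j) (+-monoʳ-< (length xs) i<j)
                (subst (length xs + j <_) (trans (sym (shift i)) (cong (length xs + i +_) (sym (entry-++ʳ xs i))))
                  (+-monoʳ-< (length xs) j<))
  ... | r rewrite entry-++ʳ xs {ys} i | entry-++ʳ xs {ys} j | shift i | shift j = r

Laminar-nested : ∀ xs d ys c zs → Laminar (xs ++ d ∷ ys ++ c ∷ zs) →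
  suc (length ys) < d → suc (length ys) + c ≤ d
Laminar-nested xs d ys c zs L lt = +-cancelˡ-≤ (length xs) _ _ nested
  where
  entry-d : entry (xs ++ d ∷ ys ++ c ∷ zs) (length xs) ≡ d
  entry-d = entry-length xs
  entry-c : entry (xs ++ d ∷ ys ++ c ∷ zs) (length xs + suc (length ys)) ≡ c
  entry-c = trans (entry-++ʳ xs (suc (length ys))) (entry-length ys)
  nested : length xs + (suc (length ys) + c) ≤ length xs + d
  nested with L (length xs) (length xs + suc (length ys)) (m<m+n (length xs) z<s)
                (subst (λ e → length xs + suc (length ys) < length xs + e) (sym entry-d) (+-monoʳ-< (length xs) lt))
  ... | r rewrite entry-d | entry-c | +-assoc (length xs) (suc (length ys)) c = r

size-node≢0 : ∀ l r → size (node l r) ≢ 0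
size-node≢0 l r eq = 1+n≢0 (trans (sym (+-suc (size l) (size r))) eq)

-- The root of a tree is the first position whose interval reaches the end.
bracket-root-position : ∀ l r l′ r′ → bracket (node l r) ≡ bracket (node l′ r′) → ¬ (size l < size l′)
bracket-root-position l r l′ r′ eq p = m+1+n≰m (size l′) (≤-trans (≤-reflexive (sym same-size)) reaches)
  where
  same-size : size (node l r) ≡ size (node l′ r′)
  same-size = trans (sym (bracket-length (node l r))) (trans (cong length eq) (bracket-length (node l′ r′)))
  root-entry : entry (bracket l′) (size l) ≡ suc (size r)
  root-entry = trans (sym (entry-node-left l′ r′ (size l) p))
                 (trans (cong (λ v → entry v (size l)) (sym eq)) (entry-node-root l r))
  reaches : size (node l r) ≤ size l′
  reaches = subst (λ e → size l + e ≤ size l′) root-entry (bracket-bounded l′ (size l) p)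

bracket-injective : ∀ T T′ → bracket T ≡ bracket T′ → T ≡ T′
bracket-injective leaf       leaf         _  = refl
bracket-injective leaf       (node l r)   eq =
  ⊥-elim (size-node≢0 l r (trans (sym (bracket-length (node l r))) (cong length (sym eq))))
bracket-injective (node l r) leaf         eq =
  ⊥-elim (size-node≢0 l r (trans (sym (bracket-length (node l r))) (cong length eq)))
bracket-injective (node l r) (node l′ r′) eq with <-cmp (size l) (size l′)
... | tri< p _ _ = ⊥-elim (bracket-root-position l r l′ r′ eq p)
... | tri> _ _ p = ⊥-elim (bracket-root-position l′ r′ l r (sym eq) p)
... | tri≈ _ p _ with ++-injective (bracket l) (trans (bracket-length l) (trans p (sym (bracket-length l′)))) eq
...   | eqˡ , eqʳ = cong₂ node (bracket-injective l l′ eqˡ) (bracket-injective r r′ (∷-injectiveʳ eqʳ))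

Rotation-interval : ∀ {T₀ T} → Rotation T₀ T → ∀ v → Laminar v →
  bracket T₀ ≤ᵥ v → v ≤ᵥ bracket T → v ≡ bracket T₀ ⊎ v ≡ bracket T
Rotation-interval (left {l₀} {l} {r} ρ) v L p₀ p₁ with Pointwise-splitˡ (bracket l₀) p₀
... | v₁ , v₂ , refl , q₀ , q₀′ with Pointwise-++⁻ v₁ same-length p₁
  where same-length = trans (sym (Pointwise-length q₀))
                        (trans (bracket-length l₀) (trans (Rotation-size ρ) (sym (bracket-length l))))
...   | q₁ , q₁′ with ≤ᵥ-antisym q₁′ q₀′ | Rotation-interval ρ v₁ (Laminar-prefix v₁ L) q₀ q₁
...     | refl | inj₁ refl = inj₁ refl
...     | refl | inj₂ refl = inj₂ refl
Rotation-interval (right {l} {r₀} {r} ρ) v L p₀ p₁ with Pointwise-splitˡ (bracket l) p₀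
... | v₁ , e ∷ v₂ , refl , q₀ , c₀ ∷ q₀′ with Pointwise-++⁻ v₁ {bracket l} (sym (Pointwise-length q₀)) p₁
...   | q₁ , c₁ ∷ q₁′ with ≤ᵥ-antisym q₁ q₀ | ≤-antisym c₁ (subst (_≤ e) (cong suc (Rotation-size ρ)) c₀)
                        | Rotation-interval ρ v₂ (Laminar-suffix (e ∷ []) (Laminar-suffix v₁ L)) q₀′ q₁′
...     | refl | refl | inj₁ refl = inj₁ (cong (λ m → bracket l ++ suc m ∷ bracket r₀) (sym (Rotation-size ρ)))
...     | refl | refl | inj₂ refl = inj₂ refl
Rotation-interval (rotate {x} {y} {z}) v L p₀ p₁
  with Pointwise-splitˡ (bracket x) (subst (_≤ᵥ v) (++-assoc (bracket x) (suc (size y) ∷ bracket y) _) p₀)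
... | v₁ , e ∷ v₂ , refl , q₀ , c₀ ∷ q₀′ with Pointwise-++⁻ v₁ {bracket x} (sym (Pointwise-length q₀)) p₁
...   | q₁ , c₁ ∷ q₁′ with ≤ᵥ-antisym q₁ q₀ | ≤ᵥ-antisym q₁′ q₀′ | e ≟ suc (size y)
...     | refl | refl | yes refl = inj₁ (sym (++-assoc (bracket x) (suc (size y) ∷ bracket y) _))
...     | refl | refl | no e≢ =
  inj₂ (cong (λ m → bracket x ++ m ∷ bracket y ++ suc (size z) ∷ bracket z) (≤-antisym c₁ reaches))
  where
  length-y = bracket-length y
  reaches : suc (size y + suc (size z)) ≤ e
  reaches = subst (λ m → suc m + suc (size z) ≤ e) length-y
              (Laminar-nested (bracket x) e (bracket y) (suc (size z)) (bracket z) L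
                (subst (λ m → suc m < e) (sym length-y) (≤∧≢⇒< c₀ (e≢ ∘ sym))))

-- The Huang–Tamari theorem

-- long-root: no rotation inside T stays below v, but v agrees with T on the left
-- subtree and lengthens the root's interval, so an ancestor of T can rotate.
data Progress (T : Tree) (v : List ℕ) : Set where
  reached   : bracket T ≡ v → Progress T v
  rotation  : ∀ T′ → Rotation T T′ → bracket T′ ≤ᵥ v → Progress T v
  long-root : ∀ {l r c v₂} → T ≡ node l r → v ≡ bracket l ++ c ∷ v₂ → suc (size r) < c → Progress T v

rotate-below-long-root : ∀ x y r {d w₂ c v₂} → Laminar (bracket x ++ d ∷ w₂ ++ c ∷ v₂) →
  bracket y ≤ᵥ w₂ → suc (size y) < d → suc (size r) ≤ c → bracket r ≤ᵥ v₂ →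
  bracket (node x (node y r)) ≤ᵥ (bracket x ++ d ∷ w₂) ++ c ∷ v₂
rotate-below-long-root x y r {d} {w₂} {c} {v₂} L y≤ y< r≤ le =
  subst (bracket (node x (node y r)) ≤ᵥ_) (sym (++-assoc (bracket x) (d ∷ w₂) (c ∷ v₂)))
    (Pointwise.++⁺ (≤ᵥ-refl {bracket x}) (d≥ ∷ Pointwise.++⁺ y≤ (r≤ ∷ le)))
  where
  length-w₂ : length w₂ ≡ size y
  length-w₂ = trans (sym (Pointwise-length y≤)) (bracket-length y)
  d≥ : suc (size y + suc (size r)) ≤ d
  d≥ = ≤-trans (+-monoʳ-≤ (suc (size y)) r≤)
         (subst (λ m → suc m + c ≤ d) length-w₂
           (Laminar-nested (bracket x) d w₂ c v₂ L (subst (λ m → suc m < d) (sym length-w₂) y<)))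

Laminar-inside-node : ∀ xs x y e zs → Laminar (xs ++ suc (size (node x y)) ∷ bracket x ++ e ∷ zs) →
  e ≤ suc (size y)
Laminar-inside-node xs x y e zs L =
  +-cancelˡ-≤ (suc (size x)) _ _
    (subst (λ m → suc m + e ≤ suc (size x) + suc (size y)) (bracket-length x)
      (Laminar-nested xs (suc (size (node x y))) (bracket x) e zs L
        (subst (λ m → suc m < suc (size (node x y))) (sym (bracket-length x)) (s≤s (m<m+n (size x) z<s)))))

progress : ∀ T v → Laminar v → bracket T ≤ᵥ v → Progress T v
progress leaf       .[] L []  = reached refl
progress (node l r) v   L le with Pointwise-splitˡ (bracket l) le
... | v₁ , c ∷ v₂ , refl , le₁ , c≥ ∷ le₂ with progress l v₁ (Laminar-prefix v₁ L) le₁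
...   | rotation l′ ρ le₁′ = rotation (node l′ r) (left ρ) (Pointwise.++⁺ le₁′ (c≥ ∷ le₂))
...   | long-root {x} {y} refl refl y< =
  rotation (node x (node y r)) rotate
    (rotate-below-long-root x y r (subst Laminar (++-assoc (bracket x) _ _) L)
      (Pointwise.tail (proj₂ (Pointwise-++⁻ (bracket x) {bracket x} refl le₁))) y< c≥ le₂)
...   | reached refl with m≤n⇒m<n∨m≡n c≥
...     | inj₁ r< = long-root refl refl r<
...     | inj₂ refl with progress r v₂ (Laminar-suffix (c ∷ []) (Laminar-suffix (bracket l) L)) le₂
...       | reached refl = reached refl
...       | rotation r′ ρ le₂′ =
  rotation (node l r′) (right ρ)
    (Pointwise.++⁺ (≤ᵥ-refl {bracket l}) (≤-reflexive (cong suc (sym (Rotation-size ρ))) ∷ le₂′))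
...       | long-root {x} {y} {e} {w₂} refl refl y< =
  ⊥-elim (<⇒≱ y< (Laminar-inside-node (bracket l) x y e w₂ L))

long-root-impossible : ∀ l r T {c v₂} → bracket T ≡ bracket l ++ c ∷ v₂ → size T ≡ size (node l r) →
  c ≤ suc (size r)
long-root-impossible l r T {c} eq same-size = +-cancelˡ-≤ (size l) _ _ (subst (size l + c ≤_) same-size reaches)
  where
  root-entry : entry (bracket T) (size l) ≡ c
  root-entry = trans (cong (λ v → entry v (size l)) eq)
                 (subst (λ i → entry (bracket l ++ c ∷ _) i ≡ c) (bracket-length l) (entry-length (bracket l)))
  reaches : size l + c ≤ size T
  reaches = subst (λ e → size l + e ≤ size T) root-entry
              (bracket-bounded T (size l) (subst (size l <_) (sym same-size) (m<m+n (size l) z<s)))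

-- Each rotation raises the sum of the bracket vector, which bounds the climb.
≤ᵥ⇒Star : ∀ T T′ → bracket T ≤ᵥ bracket T′ → Star Rotation T T′
≤ᵥ⇒Star T T′ le = climb (sum (bracket T′)) T le (m≤m+n _ _)
  where
  climb : ∀ k S → bracket S ≤ᵥ bracket T′ → sum (bracket T′) ≤ k + sum (bracket S) → Star Rotation S T′
  climb k S le fuel with progress S (bracket T′) (bracket-laminar T′) le
  ... | reached eq = subst (Star Rotation S) (bracket-injective S T′ eq) ε
  ... | rotation S₁ ρ le₁ with k
  ...   | zero  = ⊥-elim (<⇒≱ (<-≤-trans (sum-mono-<ᵥ (Rotation-bracket ρ)) (sum-mono-≤ᵥ le₁)) fuel)
  ...   | suc k = ρ ◅ climb k S₁ le₁ (≤-trans fuel (≤-trans (≤-reflexive (sym (+-suc k _)))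
                                        (+-monoʳ-≤ k (sum-mono-<ᵥ (Rotation-bracket ρ)))))
  climb k S le fuel | long-root {l} {r} refl eq r< = ⊥-elim (<⇒≱ r< (long-root-impossible l r T′ eq same-size))
    where
    same-size = trans (sym (bracket-length T′)) (trans (sym (Pointwise-length le)) (bracket-length (node l r)))

-- Pop

leftSize : Tree → ℕ
leftSize leaf       = 0
leftSize (node l _) = size l

-- Undoing a rotation at a node with right child node b c lowers the node's entry
-- from suc (size b + suc (size c)) to suc (size b); Pop does this at every node.
popBracket : Tree → List ℕ
popBracket leaf       = []
popBracket (node l r) = popBracket l ++ suc (leftSize r) ∷ popBracket r

mutual
  pop : Tree → Tree
  pop leaf       = leaf
  pop (node l r) = popSpine (pop l) r

  popSpine : Tree → Tree → Tree
  popSpine s leaf       = node s leaf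
  popSpine s (node b c) = popSpine (node s (pop b)) c

mutual
  size-pop : ∀ T → size (pop T) ≡ size T
  size-pop leaf       = refl
  size-pop (node l r) = trans (size-popSpine (pop l) r) (cong (λ m → m + suc (size r)) (size-pop l))

  size-popSpine : ∀ s r → size (popSpine s r) ≡ size s + suc (size r)
  size-popSpine s leaf       = refl
  size-popSpine s (node b c) = begin
    size (popSpine (node s (pop b)) c)          ≡⟨ size-popSpine (node s (pop b)) c ⟩
    size s + suc (size (pop b)) + suc (size c)  ≡⟨ cong (λ m → size s + suc m + suc (size c)) (size-pop b) ⟩
    size s + suc (size b) + suc (size c)        ≡⟨ +-assoc (size s) (suc (size b)) (suc (size c)) ⟩
    size s + suc (size (node b c))              ∎
    where open ≡-Reasoning

mutual
  bracket-pop : ∀ T → bracket (pop T) ≡ popBracket T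
  bracket-pop leaf       = refl
  bracket-pop (node l r) =
    trans (bracket-popSpine (pop l) r) (cong (λ v → v ++ suc (leftSize r) ∷ popBracket r) (bracket-pop l))

  bracket-popSpine : ∀ s r → bracket (popSpine s r) ≡ bracket s ++ suc (leftSize r) ∷ popBracket r
  bracket-popSpine s leaf       = refl
  bracket-popSpine s (node b c) = begin
    bracket (popSpine (node s (pop b)) c)
      ≡⟨ bracket-popSpine (node s (pop b)) c ⟩
    (bracket s ++ suc (size (pop b)) ∷ bracket (pop b)) ++ suc (leftSize c) ∷ popBracket c
      ≡⟨ cong₂ (λ m v → (bracket s ++ suc m ∷ v) ++ suc (leftSize c) ∷ popBracket c) (size-pop b) (bracket-pop b) ⟩
    (bracket s ++ suc (size b) ∷ popBracket b) ++ suc (leftSize c) ∷ popBracket c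
      ≡⟨ ++-assoc (bracket s) _ _ ⟩
    bracket s ++ suc (size b) ∷ popBracket b ++ suc (leftSize c) ∷ popBracket c ∎
    where open ≡-Reasoning

leftSize≤size : ∀ T → leftSize T ≤ size T
leftSize≤size leaf       = z≤n
leftSize≤size (node l r) = m≤m+n _ _

popBracket-≤ᵥ : ∀ T → popBracket T ≤ᵥ bracket T
popBracket-≤ᵥ leaf       = []
popBracket-≤ᵥ (node l r) = Pointwise.++⁺ (popBracket-≤ᵥ l) (s≤s (leftSize≤size r) ∷ popBracket-≤ᵥ r)

Rotation-popBracket : ∀ {T₀ T} → Rotation T₀ T → popBracket T ≤ᵥ bracket T₀
Rotation-popBracket (rotate {x} {y} {z}) =
  subst (popBracket (node x (node y z)) ≤ᵥ_) (sym (++-assoc (bracket x) (suc (size y) ∷ bracket y) _))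
    (Pointwise.++⁺ (popBracket-≤ᵥ x) (≤-refl ∷ popBracket-≤ᵥ (node y z)))
Rotation-popBracket (left {r = r} ρ) =
  Pointwise.++⁺ (Rotation-popBracket ρ) (s≤s (leftSize≤size r) ∷ popBracket-≤ᵥ r)
Rotation-popBracket (right {l} {r′ = r} ρ) =
  Pointwise.++⁺ (popBracket-≤ᵥ l)
    (s≤s (subst (leftSize r ≤_) (sym (Rotation-size ρ)) (leftSize≤size r)) ∷ Rotation-popBracket ρ)

popBracket-greatest : ∀ T u → u ≤ᵥ bracket T → (∀ T₀ → Rotation T₀ T → u ≤ᵥ bracket T₀) → u ≤ᵥ popBracket T
popBracket-greatest leaf       u le _ = le
popBracket-greatest (node l r) u le below with Pointwise-splitʳ (bracket l) le
... | u₁ , c ∷ u₂ , refl , le₁ , c≤ ∷ le₂ =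
  Pointwise.++⁺ (popBracket-greatest l u₁ le₁ below-l) (root r c≤ below ∷ popBracket-greatest r u₂ le₂ below-r)
  where
  length-u₁ = Pointwise-length le₁
  below-l : ∀ l₀ → Rotation l₀ l → u₁ ≤ᵥ bracket l₀
  below-l l₀ ρ = proj₁ (Pointwise-++⁻ u₁ {bracket l₀} {_} {suc (size r) ∷ bracket r}
                   (trans length-u₁ (trans (bracket-length l) (sym (trans (bracket-length l₀) (Rotation-size ρ)))))
                   (below (node l₀ r) (left ρ)))
  below-r : ∀ r₀ → Rotation r₀ r → u₂ ≤ᵥ bracket r₀
  below-r r₀ ρ = Pointwise.tail (proj₂ (Pointwise-++⁻ u₁ {bracket l} length-u₁ (below (node l r₀) (right ρ))))
  root : ∀ r′ → c ≤ suc (size r′) → (∀ T₀ → Rotation T₀ (node l r′) → u₁ ++ c ∷ u₂ ≤ᵥ bracket T₀) →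
         c ≤ suc (leftSize r′)
  root leaf       c≤ _      = c≤
  root (node b d) _  below′ = Pointwise.head (proj₂ (Pointwise-++⁻ u₁ {bracket l} length-u₁
    (subst (u₁ ++ c ∷ u₂ ≤ᵥ_) (++-assoc (bracket l) (suc (size b) ∷ bracket b) _)
      (below′ (node (node l b) d) rotate))))

popBracket-bound : ∀ {m} T → All (_≤ suc m) (bracket T) → All (_≤ suc (pred m)) (popBracket T)
popBracket-bound leaf       []  = []
popBracket-bound {m} (node l r) bnd =
  ++⁺ (popBracket-bound l (++⁻ˡ (bracket l) bnd)) (root r (All.head rest) ∷ popBracket-bound r (All.tail rest))
  where
  rest = ++⁻ʳ (bracket l) bnd
  root : ∀ r′ → suc (size r′) ≤ suc m → suc (leftSize r′) ≤ suc (pred m)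
  root leaf       _ = s≤s z≤n
  root (node b d) p = s≤s (suc[m]≤n⇒m≤pred[n] (≤-trans (m<m+n (size b) z<s) (≤-pred p)))

bracket-≤-size : ∀ T → All (_≤ size T) (bracket T)
bracket-≤-size leaf       = []
bracket-≤-size (node l r) =
  ++⁺ (All.map (λ p → ≤-trans p (m≤m+n _ _)) (bracket-≤-size l))
      (m≤n+m _ (size l) ∷ All.map (λ p → ≤-trans p (≤-trans (n≤1+n _) (m≤n+m _ (size l)))) (bracket-≤-size r))

leftComb : ℕ → Tree
leftComb zero    = leaf
leftComb (suc k) = node (leftComb k) leaf

size-leftComb : ∀ k → size (leftComb k) ≡ k
size-leftComb zero    = refl
size-leftComb (suc k) = trans (+-comm (size (leftComb k)) 1) (cong suc (size-leftComb k))

word-leftComb : ∀ k → word (leftComb k) ≡ minTam k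
word-leftComb zero    = refl
word-leftComb (suc k) = trans (cong (_++ N ∷ E ∷ []) (word-leftComb k)) (minTam-snoc k)
  where
  minTam-snoc : ∀ k → minTam k ++ N ∷ E ∷ [] ≡ N ∷ E ∷ minTam k
  minTam-snoc zero    = refl
  minTam-snoc (suc k) = cong (λ w → N ∷ E ∷ w) (minTam-snoc k)

bracket-≤1 : ∀ T → All (_≤ 1) (bracket T) → T ≡ leftComb (size T)
bracket-≤1 leaf         _   = refl
bracket-≤1 (node l leaf) bnd
  rewrite bracket-≤1 l (++⁻ˡ (bracket l) bnd) | size-leftComb (size l) = cong leftComb (+-comm 1 (size l))
bracket-≤1 (node l (node b d)) bnd with All.head (++⁻ʳ (bracket l) bnd)
... | s≤s p = ⊥-elim (size-node≢0 b d (n≤0⇒n≡0 p))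

-- Back to Dyck words

Move*⇒Rotation* : ∀ {T T′} → word T ≤T word T′ → Star Rotation T T′
Move*⇒Rotation* = go refl refl
  where
  go : ∀ {μ ν T T′} → μ ≡ word T → ν ≡ word T′ → Star Move μ ν → Star Rotation T T′
  go {T = T} {T′} μ≡ ν≡ ε = subst (Star Rotation T) (word-injective {T} {T′} (trans (sym μ≡) ν≡)) ε
  go {T = T} refl ν≡ (m ◅ ms) with parse (Move-ballot m (proj₁ (word-dyck T)))
  ... | T₁ , refl = Move⇒Rotation {T} {T₁} m ◅ go {T = T₁} refl ν≡ ms

≤T⇒≤ᵥ : ∀ {T T′} → word T ≤T word T′ → bracket T ≤ᵥ bracket T′
≤T⇒≤ᵥ {T} {T′} = Star-bracket ∘ Move*⇒Rotation* {T} {T′}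

≤ᵥ⇒≤T : ∀ {T T′} → bracket T ≤ᵥ bracket T′ → word T ≤T word T′
≤ᵥ⇒≤T {T} {T′} = gmap word Rotation⇒Move ∘ ≤ᵥ⇒Star T T′

_≟ₛ_ : (d d′ : Step) → Dec (d ≡ d′)
N ≟ₛ N = yes refl
N ≟ₛ E = no λ ()
E ≟ₛ N = no λ ()
E ≟ₛ E = yes refl

Star-first : ∀ {A : Set} {R : A → A → Set} {x y} → Star R x y → x ≢ y → ∃ λ z → R x z × Star R z y
Star-first ε        x≢y = ⊥-elim (x≢y refl)
Star-first (r ◅ rs) _   = _ , r , rs

Covers⇒Rotation : ∀ {n T₀ T} → Covers n (word T₀) (word T) → Rotation T₀ T
Covers⇒Rotation {n} {T₀} {T} (d₀ , (steps , T₀≢T) , no-between) with Star-first steps T₀≢T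
... | _ , m , ms with parse (Move-ballot m (proj₁ d₀))
...   | T₁ , refl with ≡-dec _≟ₛ_ (word T₁) (word T)
...     | yes eq = subst (Rotation T₀) (word-injective eq) (Move⇒Rotation {T₀} {T₁} m)
...     | no T₁≢T =
  ⊥-elim (no-between (word T₁) (proj₁ (word-dyck T₁) , length-T₁) (m ◅ ε , Move-irreflexive m) (ms , T₁≢T))
  where
  length-T₁ : length (word T₁) ≡ n * 2
  length-T₁ = trans (word-length T₁)
    (trans (cong (_* 2) (sym (Rotation-size (Move⇒Rotation {T₀} {T₁} m)))) (trans (sym (word-length T₀)) (proj₂ d₀)))

Rotation⇒Covers : ∀ {T₀ T} → Rotation T₀ T → Covers (size T) (word T₀) (word T)
Rotation⇒Covers {T₀} {T} ρ =
  subst (λ n → Dyck n (word T₀)) (Rotation-size ρ) (word-dyck T₀) ,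
  (Rotation⇒Move ρ ◅ ε , Rotation-irrefl ρ ∘ word-injective) ,
  no-between
  where
  no-between : ∀ z → Dyck (size T) z → word T₀ <T z → ¬ (z <T word T)
  no-between z dz (T₀≤z , T₀≢z) (z≤T , z≢T) with dyck⇒tree {size T} dz
  ... | Z , refl , _
    with Rotation-interval ρ (bracket Z) (bracket-laminar Z) (≤T⇒≤ᵥ {T₀} {Z} T₀≤z) (≤T⇒≤ᵥ {Z} {T} z≤T)
  ...   | inj₁ eq = T₀≢z (cong word (sym (bracket-injective Z T₀ eq)))
  ...   | inj₂ eq = z≢T (cong word (bracket-injective Z T eq))

pop-IsPop : ∀ T → IsPop (size T) (word T) (word (pop T))
pop-IsPop T = subst (λ n → Dyck n (word (pop T))) (size-pop T) (word-dyck (pop T)) , lower , greatest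
  where
  below-pop : ∀ {S} → popBracket T ≤ᵥ bracket S → word (pop T) ≤T word S
  below-pop {S} p = ≤ᵥ⇒≤T {pop T} {S} (subst (_≤ᵥ _) (sym (bracket-pop T)) p)
  lower : ∀ y → PopSet (size T) (word T) y → word (pop T) ≤T y
  lower _ (inj₂ refl) = below-pop {T} (popBracket-≤ᵥ T)
  lower _ (inj₁ cov) with dyck⇒tree {size T} (proj₁ cov)
  ... | T₀ , refl , _ = below-pop {T₀} (Rotation-popBracket (Covers⇒Rotation {size T} {T₀} {T} cov))
  greatest : ∀ l → Dyck (size T) l → (∀ y → PopSet (size T) (word T) y → l ≤T y) → l ≤T word (pop T)
  greatest l dl below with dyck⇒tree {size T} dl
  ... | L , refl , _ = ≤ᵥ⇒≤T {L} {pop T} (subst (bracket L ≤ᵥ_) (sym (bracket-pop T))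
    (popBracket-greatest T (bracket L) (≤T⇒≤ᵥ {L} {T} (below (word T) (inj₂ refl)))
      (λ T₀ ρ → ≤T⇒≤ᵥ {L} {T₀} (below (word T₀) (inj₁ (Rotation⇒Covers ρ))))))

pop-sortable : ∀ t {m} T → All (_≤ suc m) (bracket T) → m ≤ t → PopSortable (size T) t (word T)
pop-sortable zero    T bnd z≤n =
  subst (PopIter (size T) 0 (word T)) (trans (cong word (bracket-≤1 T bnd)) (word-leftComb (size T))) pop-zero
pop-sortable (suc t) T bnd m≤ = pop-suc (pop-IsPop T)
  (subst (λ n → PopSortable n t (word (pop T))) (size-pop T)
    (pop-sortable t (pop T) (subst (All _) (sym (bracket-pop T)) (popBracket-bound T bnd)) (pred-mono-≤ m≤)))

lemma3p17 : (n t : ℕ) → 1 ≤ n → n ≤ t →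
    (x : Word) → Dyck n x → PopSortable n t x
lemma3p17 n t 1≤n n≤t x dx with dyck⇒tree {n} {x} dx
... | T , refl , refl = pop-sortable t T bounded (≤⇒pred≤ n≤t)
  where
  bounded : All (_≤ suc (pred (size T))) (bracket T)
  bounded = subst (λ m → All (_≤ m) (bracket T)) (sym (suc-pred (size T) {{>-nonZero 1≤n}}))
              (bracket-≤-size T)
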